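{- Let $G=(V,E)$ be a directed graph with $n$ vertices and $\mathbb{F}$ a finite field. For all $u,v\in V$ let $x_{u,v}\in\mathbb{F}$, and for all $v\in V$ let $y_v\in\mathbb{F}$, be uniformly random, all sampled independently. Let $A\in\mathbb{F}^{n\times n}$ be given by $A_{u,v}=x_{u,v}y_v$ if $u=v$ or $uv\in E$, and $A_{u,v}=0$ otherwise. Let $u,v\in V$ and $k\in [n-1]$. Then, with probability at least $1-2k/|\mathbb{F}|$, $(A^k)_{u,v}\neq 0$ if and only if there exists a $u\to v$ path of length at most $k$ in $G$.
   Context: $V$ is identified with $\{1,\ldots,n\}$ for indexing; the length of a path is its number of edges. -}

module Defs where

open import Level using (Level; _⊔_)
open import Data.Nat using (ℕ; zero; suc)
import Data.Nat as N
open import Data.Fin using (Fin; zero; suc; inject₁; fromℕ; combine; _↑ˡ_; _↑ʳ_)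
open import Data.Vec using (Vec; lookup)
open import Data.Bool using (Bool; true; false; if_then_else_)
open import Data.List using (List; length)
open import Data.List.Relation.Unary.All using (All)
open import Data.List.Relation.Unary.Unique.Propositional using (Unique)
open import Data.Product using (Σ; ∃; _×_; _,_)
open import Data.Sum using (_⊎_)
open import Function.Bundles using (Bijection; _⇔_)
open import Function.Definitions using (Injective)
open import Relation.Nullary using (¬_; does)
open import Relation.Binary.PropositionalEquality using (_≡_)
import Relation.Binary.PropositionalEquality as ≡
open import Algebra.Bundles using (CommutativeRing)
import Data.Fin as F

record Field (c ℓ : Level) : Set (Level.suc (c ⊔ ℓ)) where
  field
    commRing : CommutativeRing c ℓ
  open CommutativeRing commRing public
  field
    1≉0     : ¬ (1# ≈ 0#)
    inverse : ∀ x → ¬ (x ≈ 0#) → Σ Carrier λ y → (x * y) ≈ 1#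

record FiniteField (c ℓ : Level) : Set (Level.suc (c ⊔ ℓ)) where
  field
    field′ : Field c ℓ
  open Field field′ public
  field
    q    : ℕ
    enum : Bijection (≡.setoid (Fin q)) setoid

  elt : Fin q → Carrier
  elt = Bijection.to enum

Graph : ℕ → Set
Graph n = Fin n → Fin n → Bool

record Path {n : ℕ} (G : Graph n) (u v : Fin n) (ℓ : ℕ) : Set where
  field
    vert     : Fin (suc ℓ) → Fin n
    distinct : Injective _≡_ _≡_ vert
    start    : vert zero ≡ u
    end      : vert (fromℕ ℓ) ≡ v
    edges    : ∀ (i : Fin ℓ) → G (vert (inject₁ i)) (vert (suc i)) ≡ true

HasPathAtMost : {n : ℕ} → Graph n → Fin n → Fin n → ℕ → Set
HasPathAtMost G u v k = ∃ λ ℓ → ℓ N.≤ k × Path G u v ℓ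

module Matrices {c ℓ} (𝔽 : FiniteField c ℓ) where
  open FiniteField 𝔽 using (Carrier; _≈_; _+_; _*_; 0#; 1#; q; elt)

  Mat : ℕ → Set c
  Mat n = Fin n → Fin n → Carrier

  sumF : (n : ℕ) → (Fin n → Carrier) → Carrier
  sumF zero    f = 0#
  sumF (suc n) f = f zero + sumF n (λ i → f (suc i))

  _⊗_ : {n : ℕ} → Mat n → Mat n → Mat n
  _⊗_ {n} M N i j = sumF n (λ k → M i k * N k j)

  idM : {n : ℕ} → Mat n
  idM i j = if does (i F.≟ j) then 1# else 0#

  _^ᴹ_ : {n : ℕ} → Mat n → ℕ → Mat n
  M ^ᴹ zero  = idM
  M ^ᴹ suc k = M ⊗ (M ^ᴹ k)

  -- Sample space: the n·n values x_{u,v} and the n values y_v, each an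
  -- index in Fin q (uniform over Fin q ≅ 𝔽); all samples equally likely.
  Sample : ℕ → Set
  Sample n = Vec (Fin q) (n N.* n N.+ n)

  xval : {n : ℕ} → Sample n → Fin n → Fin n → Carrier
  xval {n} s u v = elt (lookup s (combine u v ↑ˡ n))

  yval : {n : ℕ} → Sample n → Fin n → Carrier
  yval {n} s v = elt (lookup s ((n N.* n) ↑ʳ v))

  matA : {n : ℕ} → Graph n → Sample n → Mat n
  matA G s u v =
    if does (u F.≟ v) Data.Bool.∨ G u v then xval s u v * yval s v else 0#

  Event : {n : ℕ} → Graph n → Fin n → Fin n → ℕ → Sample n → Set ℓ
  Event G u v k s = (¬ ((matA G s ^ᴹ k) u v ≈ 0#)) ⇔ HasPathAtMost G u v k

  -- "Pr[P] ≥ 1 − t/q" over the uniform sample space: there are m distinct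
  -- samples satisfying P with m·q + t·q^N ≥ q·q^N, N = n·n + n.
  ProbAtLeast1- : (n : ℕ) → (Sample n → Set ℓ) → ℕ → Set ℓ
  ProbAtLeast1- n P t =
    Σ (List (Sample n)) λ S → Unique S × All P S ×
      (q N.* q N.^ (n N.* n N.+ n) N.≤ length S N.* q N.+ t N.* q N.^ (n N.* n N.+ n))

module Submission where

-- The entry (Aᵏ)_{u,v} is the evaluation of a polynomial of total degree at most 2k in the
-- variables x_{a,b}, y_b, and a nonzero entry of Aᵏ yields a walk, hence a path, of length ≤ k.
-- If the polynomial does not vanish at every sample, Schwartz–Zippel (by induction on the number
-- of variables, counting roots in the first one) shows that at most a 2k/|𝔽| fraction of samples
-- are zeros, and the event holds at all other samples. If it vanishes everywhere, then no path of
-- length ≤ k exists: along such a path, setting x = 1 on the path edges and on the loop at v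
-- (0 elsewhere) and y = 1 turns A into the matrix of a map moving one step along the path, whose
-- k-th power has (u,v) entry 1. So the event then holds at every sample.

open import Defs
import Level
open import Data.Nat using (ℕ; zero; suc)
open import Data.Fin using (Fin)

import Data.Nat.Properties as NP
import Data.Fin as F
import Data.Fin.Properties as FP
open import Data.Vec using (Vec; []; _∷_)
open import Data.List using (List; length; filter; cartesianProductWith; allFin; map)
import Data.List as L
import Data.List.Properties as LP
import Data.Nat.ListAction as ℕL
import Data.Nat.ListAction.Properties as ℕLP
open import Data.List.Relation.Unary.All using (All)
import Data.List.Relation.Unary.All as All
open import Data.List.Relation.Unary.Unique.Propositional using (Unique)
import Data.List.Relation.Unary.AllPairs as AllPairs
import Data.List.Relation.Unary.Unique.Propositional.Properties as UP
open import Data.Product using (∃; _×_; _,_; proj₁; proj₂)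
open import Data.Unit using (⊤; tt)
open import Data.Empty using (⊥-elim)
open import Function using (_∘_; Bijection)
open import Relation.Nullary using (¬_; Dec; yes; no; does)
open import Relation.Binary.PropositionalEquality
  using (_≡_; _≢_; refl; cong; cong₂; subst; module ≡-Reasoning)
import Relation.Binary.PropositionalEquality as ≡
import Relation.Binary.Reasoning.Setoid as SetoidReasoning

module NatSums where
  open import Data.Nat using (_+_; _*_; _≤_; z≤n; s≤s)
  open import Relation.Nullary.Decidable using (¬?)
  open import Algebra.Properties.Semiring.Sum NP.+-*-semiring public
    using (sum; sum-syntax; sum-cong-≗; sum-remove; sum-replicate-zero; ∑-distrib-+; ∑-comm; *-distribˡ-sum)

  indicator : ∀ {p} {P : Set p} → Dec P → ℕ
  indicator (yes _) = 1
  indicator (no _)  = 0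

  indicator≤1 : ∀ {p} {P : Set p} (P? : Dec P) → indicator P? ≤ 1
  indicator≤1 (yes _) = s≤s z≤n
  indicator≤1 (no _)  = z≤n

  indicator-¬? : ∀ {p} {P : Set p} (P? : Dec P) → indicator (¬? P?) + indicator P? ≡ 1
  indicator-¬? (yes _) = refl
  indicator-¬? (no _)  = refl

  ∑-mono-≤ : ∀ {m} {f g : Fin m → ℕ} → (∀ i → f i ≤ g i) → sum f ≤ sum g
  ∑-mono-≤ {zero}  f≤g = z≤n
  ∑-mono-≤ {suc m} f≤g = NP.+-mono-≤ (f≤g F.zero) (∑-mono-≤ (f≤g ∘ F.suc))

  ∑-const : ∀ m k → ∑[ i < m ] k ≡ m * k
  ∑-const zero    k = refl
  ∑-const (suc m) k = cong (k +_) (∑-const m k)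

  ∑-indicator-≡ : ∀ {m} (t : Fin m) → ∑[ i < m ] indicator (i F.≟ t) ≡ 1
  ∑-indicator-≡ {suc m} t = begin
    ∑[ i < suc m ] indicator (i F.≟ t)                     ≡⟨ sum-remove {i = t} (λ i → indicator (i F.≟ t)) ⟩
    indicator (t F.≟ t) + ∑[ i < m ] indicator (F.punchIn t i F.≟ t)
      ≡⟨ cong₂ _+_ (hit (t F.≟ t)) (≡.trans (sum-cong-≗ {m} (λ i → miss (FP.punchInᵢ≢i t i))) (sum-replicate-zero m)) ⟩
    1 ∎
    where
    open ≡-Reasoning
    hit : (d : Dec (t ≡ t)) → indicator d ≡ 1
    hit (yes _)  = refl
    hit (no t≢t) = ⊥-elim (t≢t refl)
    miss : ∀ {i} → ¬ i ≡ t → indicator (i F.≟ t) ≡ 0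
    miss {i} i≢t with i F.≟ t
    ... | yes i≡t = ⊥-elim (i≢t i≡t)
    ... | no _    = refl

  length-filter≡sum-indicator : ∀ {a p} {A : Set a} {P : A → Set p} (P? : ∀ x → Dec (P x)) xs →
    length (filter P? xs) ≡ ℕL.sum (map (indicator ∘ P?) xs)
  length-filter≡sum-indicator P? L.[] = refl
  length-filter≡sum-indicator P? (x L.∷ xs) with P? x
  ... | yes _ = cong suc (length-filter≡sum-indicator P? xs)
  ... | no _  = length-filter≡sum-indicator P? xs

module Vectors (q : ℕ) where
  open import Data.Nat using (_+_; _*_; _^_; _≤_)
  open NatSums

  ∑ᵛ : ∀ M → (Vec (Fin q) M → ℕ) → ℕ
  ∑ᵛ zero    f = f []
  ∑ᵛ (suc M) f = ∑[ t < q ] ∑ᵛ M (λ s → f (t ∷ s))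

  ∑ᵛ-cong : ∀ M {f g : Vec (Fin q) M → ℕ} → (∀ s → f s ≡ g s) → ∑ᵛ M f ≡ ∑ᵛ M g
  ∑ᵛ-cong zero    f≡g = f≡g []
  ∑ᵛ-cong (suc M) f≡g = sum-cong-≗ {q} (λ t → ∑ᵛ-cong M (λ s → f≡g (t ∷ s)))

  ∑ᵛ-mono-≤ : ∀ M {f g : Vec (Fin q) M → ℕ} → (∀ s → f s ≤ g s) → ∑ᵛ M f ≤ ∑ᵛ M g
  ∑ᵛ-mono-≤ zero    f≤g = f≤g []
  ∑ᵛ-mono-≤ (suc M) f≤g = ∑-mono-≤ (λ t → ∑ᵛ-mono-≤ M (λ s → f≤g (t ∷ s)))

  ∑ᵛ-distrib-+ : ∀ M (f g : Vec (Fin q) M → ℕ) → ∑ᵛ M (λ s → f s + g s) ≡ ∑ᵛ M f + ∑ᵛ M g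
  ∑ᵛ-distrib-+ zero    f g = refl
  ∑ᵛ-distrib-+ (suc M) f g = ≡.trans (sum-cong-≗ {q} (λ t → ∑ᵛ-distrib-+ M _ _)) (∑-distrib-+ {q} _ _)

  ∑ᵛ-distribˡ-* : ∀ M k (f : Vec (Fin q) M → ℕ) → ∑ᵛ M (λ s → k * f s) ≡ k * ∑ᵛ M f
  ∑ᵛ-distribˡ-* zero    k f = refl
  ∑ᵛ-distribˡ-* (suc M) k f = ≡.trans (sum-cong-≗ {q} (λ t → ∑ᵛ-distribˡ-* M k _)) (≡.sym (*-distribˡ-sum {q} k _))

  ∑ᵛ-const : ∀ M k → ∑ᵛ M (λ _ → k) ≡ q ^ M * k
  ∑ᵛ-const zero    k = ≡.sym (NP.+-identityʳ k)
  ∑ᵛ-const (suc M) k = begin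
    ∑[ t < q ] ∑ᵛ M (λ _ → k)  ≡⟨ sum-cong-≗ {q} (λ _ → ∑ᵛ-const M k) ⟩
    ∑[ t < q ] (q ^ M * k)     ≡⟨ ∑-const q _ ⟩
    q * (q ^ M * k)            ≡⟨ NP.*-assoc q _ k ⟨
    q ^ suc M * k              ∎
    where open ≡-Reasoning

  ∑ᵛ-comm : ∀ M (f : Fin q → Vec (Fin q) M → ℕ) → ∑ᵛ M (λ s → ∑[ t < q ] f t s) ≡ ∑[ t < q ] ∑ᵛ M (f t)
  ∑ᵛ-comm zero    f = refl
  ∑ᵛ-comm (suc M) f = ≡.trans (sum-cong-≗ {q} (λ t′ → ∑ᵛ-comm M (λ t s → f t (t′ ∷ s))))
                            (∑-comm {q} {q} (λ t′ t → ∑ᵛ M (λ s → f t (t′ ∷ s))))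

  any? : ∀ {p} M {P : Vec (Fin q) M → Set p} → (∀ s → Dec (P s)) → Dec (∃ P)
  any? zero    P? with P? []
  ... | yes p = yes ([] , p)
  ... | no ¬p = no λ { ([] , p) → ¬p p }
  any? (suc M) P? with FP.any? (λ t → any? M (λ s → P? (t ∷ s)))
  ... | yes (t , s , p) = yes (t ∷ s , p)
  ... | no ¬p           = no λ { (t ∷ s , p) → ¬p (t , s , p) }

  allVecs : ∀ M → List (Vec (Fin q) M)
  allVecs zero    = L.[ [] ]
  allVecs (suc M) = cartesianProductWith _∷_ (allFin q) (allVecs M)

  allVecs-unique : ∀ M → Unique (allVecs M)
  allVecs-unique zero    = All.[] AllPairs.∷ AllPairs.[]
  allVecs-unique (suc M) = UP.cartesianProductWith⁺ _∷_ ∷-injective (UP.allFin⁺ q) (allVecs-unique M)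
    where
    ∷-injective : ∀ {t t′ : Fin q} {s s′ : Vec (Fin q) M} → t ∷ s ≡ t′ ∷ s′ → t ≡ t′ × s ≡ s′
    ∷-injective refl = refl , refl

  sum-map-cartesianProduct : ∀ {M} m (g : Fin m → Fin q) (ys : List (Vec (Fin q) M)) (f : Vec (Fin q) (suc M) → ℕ) →
    ℕL.sum (map f (cartesianProductWith _∷_ (L.tabulate g) ys)) ≡ ∑[ i < m ] ℕL.sum (map (f ∘ (g i ∷_)) ys)
  sum-map-cartesianProduct zero    g ys f = refl
  sum-map-cartesianProduct (suc m) g ys f = begin
    ℕL.sum (map f (map (g F.zero ∷_) ys L.++ rest))             ≡⟨ cong ℕL.sum (LP.map-++ f (map (g F.zero ∷_) ys) rest) ⟩
    ℕL.sum (map f (map (g F.zero ∷_) ys) L.++ map f rest)       ≡⟨ ℕLP.sum-++ (map f (map (g F.zero ∷_) ys)) (map f rest) ⟩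
    ℕL.sum (map f (map (g F.zero ∷_) ys)) + ℕL.sum (map f rest)
      ≡⟨ cong₂ _+_ (cong ℕL.sum (≡.sym (LP.map-∘ ys))) (sum-map-cartesianProduct m (g ∘ F.suc) ys f) ⟩
    ∑[ i < suc m ] ℕL.sum (map (f ∘ (g i ∷_)) ys) ∎
    where
    open ≡-Reasoning
    rest = cartesianProductWith _∷_ (L.tabulate (g ∘ F.suc)) ys

  sum-map-allVecs : ∀ M (f : Vec (Fin q) M → ℕ) → ℕL.sum (map f (allVecs M)) ≡ ∑ᵛ M f
  sum-map-allVecs zero    f = NP.+-identityʳ (f [])
  sum-map-allVecs (suc M) f = ≡.trans (sum-map-cartesianProduct q (λ t → t) (allVecs M) f)
                                    (sum-cong-≗ {q} (λ t → sum-map-allVecs M (f ∘ (t ∷_))))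

  length-filter-allVecs : ∀ {p} M {P : Vec (Fin q) M → Set p} (P? : ∀ s → Dec (P s)) →
    length (filter P? (allVecs M)) ≡ ∑ᵛ M (indicator ∘ P?)
  length-filter-allVecs M P? = ≡.trans (length-filter≡sum-indicator P? (allVecs M)) (sum-map-allVecs M _)

  length-allVecs : ∀ M → length (allVecs M) ≡ q ^ M
  length-allVecs M = begin
    length (allVecs M)                  ≡⟨ cong length (LP.filter-all always (All.universal (λ _ → tt) (allVecs M))) ⟨
    length (filter always (allVecs M))  ≡⟨ length-filter-allVecs M always ⟩
    ∑ᵛ M (λ _ → 1)                      ≡⟨ ∑ᵛ-const M 1 ⟩
    q ^ M * 1                           ≡⟨ NP.*-identityʳ _ ⟩
    q ^ M                               ∎
    where
    open ≡-Reasoning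
    always : ∀ s → Dec ⊤
    always _ = yes tt

module FieldFacts {c ℓ} (𝔽 : FiniteField c ℓ) where
  open FiniteField 𝔽 renaming (refl to ≈-refl)
  open import Relation.Binary.Reasoning.Setoid setoid
  open import Algebra.Properties.Ring ring using ([y-z]x≈yx-zx)
  open import Algebra.Properties.Group +-group using (x≈y⇒x∙y⁻¹≈ε; x∙y⁻¹≈ε⇒x≈y)
  open import Data.Sum using (_⊎_; inj₁; inj₂)

  index : Carrier → Fin q
  index x = proj₁ (Bijection.strictlySurjective enum x)

  elt-index : ∀ x → elt (index x) ≈ x
  elt-index x = proj₂ (Bijection.strictlySurjective enum x)

  elt-injective : ∀ {i j} → elt i ≈ elt j → i ≡ j
  elt-injective = Bijection.injective enum

  infix 4 _≈?_
  _≈?_ : ∀ x y → Dec (x ≈ y)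
  x ≈? y with index x F.≟ index y
  ... | yes eq = yes (begin
    x              ≈⟨ elt-index x ⟨
    elt (index x)  ≡⟨ cong elt eq ⟩
    elt (index y)  ≈⟨ elt-index y ⟩
    y              ∎)
  ... | no neq = no λ x≈y → neq (elt-injective (trans (elt-index x) (trans x≈y (sym (elt-index y)))))

  ≈-stable : ∀ {x y} → ¬ ¬ x ≈ y → x ≈ y
  ≈-stable {x} {y} ¬¬x≈y with x ≈? y
  ... | yes x≈y = x≈y
  ... | no x≉y  = ⊥-elim (¬¬x≈y x≉y)

  zero-product : ∀ x y → x * y ≈ 0# → x ≈ 0# ⊎ y ≈ 0#
  zero-product x y xy≈0 with x ≈? 0#
  ... | yes x≈0 = inj₁ x≈0
  ... | no x≉0 with inverse x x≉0
  ... | x⁻¹ , xx⁻¹≈1 = inj₂ (begin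
    y              ≈⟨ *-identityˡ y ⟨
    1# * y         ≈⟨ *-congʳ xx⁻¹≈1 ⟨
    x * x⁻¹ * y    ≈⟨ *-congʳ (*-comm x x⁻¹) ⟩
    x⁻¹ * x * y    ≈⟨ *-assoc x⁻¹ x y ⟩
    x⁻¹ * (x * y)  ≈⟨ *-congˡ xy≈0 ⟩
    x⁻¹ * 0#       ≈⟨ zeroʳ x⁻¹ ⟩
    0#             ∎)

  nonzero-*ˡ : ∀ {x y} → ¬ x * y ≈ 0# → ¬ x ≈ 0#
  nonzero-*ˡ {x} {y} xy≉0 x≈0 = xy≉0 (trans (*-congʳ x≈0) (zeroˡ y))

  nonzero-*ʳ : ∀ {x y} → ¬ x * y ≈ 0# → ¬ y ≈ 0#
  nonzero-*ʳ {x} {y} xy≉0 y≈0 = xy≉0 (trans (*-congˡ y≈0) (zeroʳ x))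

  *-cancelʳ-nonzero : ∀ a b z → a * z ≈ b * z → ¬ a ≈ b → z ≈ 0#
  *-cancelʳ-nonzero a b z az≈bz a≉b with zero-product (a - b) z [a-b]z≈0
    where
    [a-b]z≈0 : (a - b) * z ≈ 0#
    [a-b]z≈0 = trans ([y-z]x≈yx-zx z a b) (x≈y⇒x∙y⁻¹≈ε az≈bz)
  ... | inj₁ a-b≈0 = ⊥-elim (a≉b (x∙y⁻¹≈ε⇒x≈y a b a-b≈0))
  ... | inj₂ z≈0   = z≈0

module Univariate {c ℓ} (𝔽 : FiniteField c ℓ) where
  open FiniteField 𝔽 renaming (refl to ≈-refl)
  open FieldFacts 𝔽
  open import Algebra.Solver.Ring.NaturalCoefficients.Default commutativeSemiring
    using (solve; _:=_; _:+_; _:*_)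
  open NatSums using (indicator; indicator≤1; sum; sum-syntax; sum-cong-≗; ∑-mono-≤; ∑-const; ∑-indicator-≡; ∑-distrib-+)
  import Data.Nat as ℕ

  horner : List Carrier → Carrier → Carrier
  horner L.[]       x = 0#
  horner (a L.∷ as) x = a + x * horner as x

  -- Synthetic division by X − a.
  divide : List Carrier → Carrier → List Carrier
  divide L.[]       a = L.[]
  divide (b L.∷ bs) a = horner bs a L.∷ divide bs a

  -- p(x) − p(a) = (x − a)·(p ÷ (X − a))(x), with the subtractions moved across.
  horner-divide : ∀ cs a x → horner cs x + a * horner (divide cs a) x ≈ horner cs a + x * horner (divide cs a) x
  horner-divide L.[]       a x = trans (+-congˡ (zeroʳ a)) (sym (+-congˡ (zeroʳ x)))
  horner-divide (b L.∷ bs) a x = begin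
    (b + x * horner bs x) + a * (horner bs a + x * Q)  ≈⟨ regroup b x a (horner bs x) Q (horner bs a) ⟩
    (b + a * horner bs a) + x * (horner bs x + a * Q)  ≈⟨ +-congˡ (*-congˡ (horner-divide bs a x)) ⟩
    (b + a * horner bs a) + x * (horner bs a + x * Q)  ∎
    where
    open SetoidReasoning setoid
    Q = horner (divide bs a) x
    regroup : ∀ b x a h Q ha → (b + x * h) + a * (ha + x * Q) ≈ (b + a * ha) + x * (h + a * Q)
    regroup = solve 6 (λ b x a h Q ha → (b :+ x :* h) :+ a :* (ha :+ x :* Q) := (b :+ a :* ha) :+ x :* (h :+ a :* Q)) ≈-refl

  AllZero : List Carrier → Set (c Level.⊔ ℓ)
  AllZero = All (_≈ 0#)

  horner-allZero : ∀ {as} → AllZero as → ∀ x → horner as x ≈ 0#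
  horner-allZero All.[]           x = ≈-refl
  horner-allZero (a≈0 All.∷ as≈0) x = trans (+-cong a≈0 (trans (*-congˡ (horner-allZero as≈0 x)) (zeroʳ x))) (+-identityʳ 0#)

  divide-allZero : ∀ {as} → AllZero as → ∀ a → AllZero (divide as a)
  divide-allZero All.[]          a = All.[]
  divide-allZero (_ All.∷ as≈0) a = horner-allZero as≈0 a All.∷ divide-allZero as≈0 a

  data HasDegree : ℕ → List Carrier → Set (c Level.⊔ ℓ) where
    leading : ∀ {a as} → ¬ a ≈ 0# → AllZero as → HasDegree 0 (a L.∷ as)
    later   : ∀ {j a as} → HasDegree j as → HasDegree (suc j) (a L.∷ as)

  horner-constant : ∀ {a as} → AllZero as → ∀ x → horner (a L.∷ as) x ≈ a
  horner-constant {a} as≈0 x = trans (+-congˡ (trans (*-congˡ (horner-allZero as≈0 x)) (zeroʳ x))) (+-identityʳ a)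

  horner-degree0 : ∀ {cs} → HasDegree 0 cs → ∀ x → ¬ horner cs x ≈ 0#
  horner-degree0 (leading a≉0 as≈0) x p≈0 = a≉0 (trans (sym (horner-constant as≈0 x)) p≈0)

  divide-degree : ∀ {j cs} → HasDegree (suc j) cs → ∀ a → HasDegree j (divide cs a)
  divide-degree (later (leading b≉0 bs≈0)) a =
    leading (λ p≈0 → b≉0 (trans (sym (horner-constant bs≈0 a)) p≈0)) (horner-allZero bs≈0 a All.∷ divide-allZero bs≈0 a)
  divide-degree (later d@(later _)) a = later (divide-degree d a)

  root-of-divide : ∀ cs {a x} → horner cs a ≈ 0# → horner cs x ≈ 0# → ¬ x ≈ a → horner (divide cs a) x ≈ 0#
  root-of-divide cs {a} {x} pa≈0 px≈0 x≉a = *-cancelʳ-nonzero a x Q aQ≈xQ (x≉a ∘ sym)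
    where
    open SetoidReasoning setoid
    Q = horner (divide cs a) x
    aQ≈xQ : a * Q ≈ x * Q
    aQ≈xQ = begin
      a * Q                      ≈⟨ +-identityˡ _ ⟨
      0# + a * Q                 ≈⟨ +-congʳ px≈0 ⟨
      horner cs x + a * Q        ≈⟨ horner-divide cs a x ⟩
      horner cs a + x * Q        ≈⟨ +-congʳ pa≈0 ⟩
      0# + x * Q                 ≈⟨ +-identityˡ _ ⟩
      x * Q                      ∎

  #roots : List Carrier → ℕ
  #roots cs = ∑[ t < q ] indicator (horner cs (elt t) ≈? 0#)

  #roots≤q : ∀ cs → #roots cs ℕ.≤ q
  #roots≤q cs = NP.≤-trans (∑-mono-≤ (λ t → indicator≤1 (horner cs (elt t) ≈? 0#)))
                           (NP.≤-reflexive (≡.trans (∑-const q 1) (NP.*-identityʳ q)))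

  #roots-none : ∀ cs → (∀ t → ¬ horner cs (elt t) ≈ 0#) → #roots cs ≡ 0
  #roots-none cs none = ≡.trans (sum-cong-≗ {q} miss) (≡.trans (∑-const q 0) (NP.*-zeroʳ q))
    where
    miss : ∀ t → indicator (horner cs (elt t) ≈? 0#) ≡ 0
    miss t with horner cs (elt t) ≈? 0#
    ... | yes root = ⊥-elim (none t root)
    ... | no _     = refl

  #roots≤degree : ∀ {j cs} → HasDegree j cs → #roots cs ℕ.≤ j
  #roots≤degree {cs = cs} d@(leading _ _) = NP.≤-reflexive (#roots-none cs (horner-degree0 d ∘ elt))
  #roots≤degree {suc j} {cs} d@(later _) with FP.any? (λ t → horner cs (elt t) ≈? 0#)
  ... | no none = NP.≤-trans (NP.≤-reflexive (#roots-none cs (λ t root → none (t , root)))) ℕ.z≤n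
  ... | yes (t₀ , root₀) = begin
    #roots cs                                                       ≤⟨ ∑-mono-≤ split ⟩
    ∑[ t < q ] (indicator (t F.≟ t₀) ℕ.+ indicator (Q t ≈? 0#))     ≡⟨ ∑-distrib-+ {q} _ _ ⟩
    ∑[ t < q ] indicator (t F.≟ t₀) ℕ.+ #roots qs                  ≡⟨ cong (ℕ._+ #roots qs) (∑-indicator-≡ t₀) ⟩
    suc (#roots qs)                                                 ≤⟨ ℕ.s≤s (#roots≤degree (divide-degree d (elt t₀))) ⟩
    suc j                                                           ∎
    where
    open NP.≤-Reasoning
    qs = divide cs (elt t₀)
    Q : Fin q → Carrier
    Q t = horner qs (elt t)
    split : ∀ t → indicator (horner cs (elt t) ≈? 0#) ℕ.≤ indicator (t F.≟ t₀) ℕ.+ indicator (Q t ≈? 0#)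
    split t with horner cs (elt t) ≈? 0# | t F.≟ t₀ | Q t ≈? 0#
    ... | no _     | _        | _    = ℕ.z≤n
    ... | yes _    | yes _    | _    = ℕ.s≤s ℕ.z≤n
    ... | yes _    | no _     | yes _ = NP.≤-refl
    ... | yes root | no t≢t₀  | no Q≉0 =
      ⊥-elim (Q≉0 (root-of-divide cs root₀ root (t≢t₀ ∘ elt-injective)))

module Multivariate {c ℓ} (𝔽 : FiniteField c ℓ) where
  open FiniteField 𝔽 renaming (refl to ≈-refl)
  open Univariate 𝔽 using (horner)
  open import Algebra.Solver.Ring.NaturalCoefficients.Default commutativeSemiring
    using (solve; _:=_; _:+_; _:*_)
  open import Data.Vec using (lookup)

  -- poly ps is the polynomial ∑ᵢ psᵢ · X₀ⁱ, whose coefficients psᵢ involve the remaining variables.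
  data Poly : ℕ → Set c where
    con  : Carrier → Poly 0
    poly : ∀ {M} → List (Poly M) → Poly (suc M)

  mutual
    eval : ∀ {M} → Poly M → Vec Carrier M → Carrier
    eval (con a)   []  = a
    eval (poly ps) env = evalᴸ ps env

    evalᴸ : ∀ {M} → List (Poly M) → Vec Carrier (suc M) → Carrier
    evalᴸ L.[]       env       = 0#
    evalᴸ (p L.∷ ps) (x ∷ env) = eval p env + x * evalᴸ ps (x ∷ env)

  coefficients : ∀ {M} → List (Poly M) → Vec Carrier M → List Carrier
  coefficients ps env = map (λ p → eval p env) ps

  horner-coefficients : ∀ {M} (ps : List (Poly M)) x env → horner (coefficients ps env) x ≡ evalᴸ ps (x ∷ env)
  horner-coefficients L.[]       x env = refl
  horner-coefficients (p L.∷ ps) x env = cong (λ h → eval p env + x * h) (horner-coefficients ps x env)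

  0ᴾ : ∀ {M} → Poly M
  0ᴾ {zero}  = con 0#
  0ᴾ {suc M} = poly L.[]

  constᴾ : ∀ {M} → Carrier → Poly M
  constᴾ {zero}  a = con a
  constᴾ {suc M} a = poly L.[ constᴾ a ]

  varᴾ : ∀ {M} → Fin M → Poly M
  varᴾ F.zero    = poly (0ᴾ L.∷ L.[ constᴾ 1# ])
  varᴾ (F.suc i) = poly L.[ varᴾ i ]

  infixl 6 _+ᴾ_ _+ᴸ_
  infixl 7 _*ᴾ_ _*ᴸ_ _·ᴸ_

  mutual
    _+ᴾ_ : ∀ {M} → Poly M → Poly M → Poly M
    con a   +ᴾ con b   = con (a + b)
    poly ps +ᴾ poly rs = poly (ps +ᴸ rs)

    _+ᴸ_ : ∀ {M} → List (Poly M) → List (Poly M) → List (Poly M)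
    L.[]       +ᴸ rs         = rs
    (p L.∷ ps) +ᴸ L.[]       = p L.∷ ps
    (p L.∷ ps) +ᴸ (r L.∷ rs) = p +ᴾ r L.∷ ps +ᴸ rs

  mutual
    _*ᴾ_ : ∀ {M} → Poly M → Poly M → Poly M
    con a   *ᴾ con b   = con (a * b)
    poly ps *ᴾ poly rs = poly (ps *ᴸ rs)

    _*ᴸ_ : ∀ {M} → List (Poly M) → List (Poly M) → List (Poly M)
    L.[]       *ᴸ rs = L.[]
    (p L.∷ ps) *ᴸ rs = p ·ᴸ rs +ᴸ (0ᴾ L.∷ ps *ᴸ rs)

    _·ᴸ_ : ∀ {M} → Poly M → List (Poly M) → List (Poly M)
    p ·ᴸ L.[]       = L.[]
    p ·ᴸ (r L.∷ rs) = p *ᴾ r L.∷ p ·ᴸ rs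

  private
    +-*-interchange : ∀ a b x u v → (a + b) + x * (u + v) ≈ (a + x * u) + (b + x * v)
    +-*-interchange = solve 5 (λ a b x u v → (a :+ b) :+ x :* (u :+ v) := (a :+ x :* u) :+ (b :+ x :* v)) ≈-refl
    *-distribˡ-shifted : ∀ p r₀ x rs → p * r₀ + x * (p * rs) ≈ p * (r₀ + x * rs)
    *-distribˡ-shifted = solve 4 (λ p r₀ x rs → p :* r₀ :+ x :* (p :* rs) := p :* (r₀ :+ x :* rs)) ≈-refl
    *-distribʳ-shifted : ∀ p rs x ps → p * rs + x * (ps * rs) ≈ (p + x * ps) * rs
    *-distribʳ-shifted = solve 4 (λ p rs x ps → p :* rs :+ x :* (ps :* rs) := (p :+ x :* ps) :* rs) ≈-refl

  x+y*0≈x : ∀ a y → a + y * 0# ≈ a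
  x+y*0≈x a y = trans (+-congˡ (zeroʳ y)) (+-identityʳ a)

  eval-0ᴾ : ∀ {M} (env : Vec Carrier M) → eval 0ᴾ env ≈ 0#
  eval-0ᴾ []      = ≈-refl
  eval-0ᴾ (_ ∷ _) = ≈-refl

  eval-constᴾ : ∀ {M} a (env : Vec Carrier M) → eval (constᴾ a) env ≈ a
  eval-constᴾ a []        = ≈-refl
  eval-constᴾ a (x ∷ env) = trans (x+y*0≈x _ x) (eval-constᴾ a env)

  eval-varᴾ : ∀ {M} (i : Fin M) (env : Vec Carrier M) → eval (varᴾ i) env ≈ lookup env i
  eval-varᴾ F.zero    (x ∷ env) = begin
    eval 0ᴾ env + x * (eval (constᴾ 1#) env + x * 0#)
      ≈⟨ +-cong (eval-0ᴾ env) (*-congˡ (trans (x+y*0≈x _ x) (eval-constᴾ 1# env))) ⟩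
    0# + x * 1#                                         ≈⟨ +-identityˡ _ ⟩
    x * 1#                                              ≈⟨ *-identityʳ x ⟩
    x                                                   ∎
    where open SetoidReasoning setoid
  eval-varᴾ (F.suc i) (x ∷ env) = trans (x+y*0≈x _ x) (eval-varᴾ i env)

  mutual
    eval-+ᴾ : ∀ {M} (p r : Poly M) env → eval (p +ᴾ r) env ≈ eval p env + eval r env
    eval-+ᴾ (con a)   (con b)   []  = ≈-refl
    eval-+ᴾ (poly ps) (poly rs) env = evalᴸ-+ᴸ ps rs env

    evalᴸ-+ᴸ : ∀ {M} (ps rs : List (Poly M)) env → evalᴸ (ps +ᴸ rs) env ≈ evalᴸ ps env + evalᴸ rs env
    evalᴸ-+ᴸ L.[]       rs         env       = sym (+-identityˡ _)
    evalᴸ-+ᴸ (p L.∷ ps) L.[]       env       = sym (+-identityʳ _)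
    evalᴸ-+ᴸ (p L.∷ ps) (r L.∷ rs) (x ∷ env) =
      trans (+-cong (eval-+ᴾ p r env) (*-congˡ (evalᴸ-+ᴸ ps rs (x ∷ env)))) (+-*-interchange _ _ x _ _)

  mutual
    eval-*ᴾ : ∀ {M} (p r : Poly M) env → eval (p *ᴾ r) env ≈ eval p env * eval r env
    eval-*ᴾ (con a)   (con b)   []  = ≈-refl
    eval-*ᴾ (poly ps) (poly rs) env = evalᴸ-*ᴸ ps rs env

    evalᴸ-*ᴸ : ∀ {M} (ps rs : List (Poly M)) env → evalᴸ (ps *ᴸ rs) env ≈ evalᴸ ps env * evalᴸ rs env
    evalᴸ-*ᴸ L.[]       rs env       = sym (zeroˡ _)
    evalᴸ-*ᴸ (p L.∷ ps) rs (x ∷ env) = begin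
      evalᴸ (p ·ᴸ rs +ᴸ (0ᴾ L.∷ ps *ᴸ rs)) (x ∷ env)
        ≈⟨ evalᴸ-+ᴸ (p ·ᴸ rs) (0ᴾ L.∷ ps *ᴸ rs) (x ∷ env) ⟩
      evalᴸ (p ·ᴸ rs) (x ∷ env) + (eval 0ᴾ env + x * evalᴸ (ps *ᴸ rs) (x ∷ env))
        ≈⟨ +-cong (evalᴸ-·ᴸ p rs x env) (trans (+-congʳ (eval-0ᴾ env)) (+-identityˡ _)) ⟩
      eval p env * R + x * evalᴸ (ps *ᴸ rs) (x ∷ env)        ≈⟨ +-congˡ (*-congˡ (evalᴸ-*ᴸ ps rs (x ∷ env))) ⟩
      eval p env * R + x * (evalᴸ ps (x ∷ env) * R)          ≈⟨ *-distribʳ-shifted _ _ x _ ⟩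
      (eval p env + x * evalᴸ ps (x ∷ env)) * R              ∎
      where
      open SetoidReasoning setoid
      R = evalᴸ rs (x ∷ env)

    evalᴸ-·ᴸ : ∀ {M} (p : Poly M) rs x env → evalᴸ (p ·ᴸ rs) (x ∷ env) ≈ eval p env * evalᴸ rs (x ∷ env)
    evalᴸ-·ᴸ p L.[]       x env = sym (zeroʳ _)
    evalᴸ-·ᴸ p (r L.∷ rs) x env =
      trans (+-cong (eval-*ᴾ p r env) (*-congˡ (evalᴸ-·ᴸ p rs x env))) (*-distribˡ-shifted _ _ x _)

module Degree {c ℓ} (𝔽 : FiniteField c ℓ) where
  open FiniteField 𝔽 using (1#)
  open Multivariate 𝔽
  open import Data.Nat using (_+_; _⊔_; _≤_; z≤n; s≤s)
  open NP using (≤-refl; ≤-reflexive; ≤-trans; ⊔-lub; ⊔-mono-≤; m≤m⊔n; m≤n⊔m)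

  mutual
    deg : ∀ {M} → Poly M → ℕ
    deg (con _)   = 0
    deg (poly ps) = degᴸ ps

    degᴸ : ∀ {M} → List (Poly M) → ℕ
    degᴸ L.[]       = 0
    degᴸ (p L.∷ ps) = deg p ⊔ degShiftᴸ ps

    degShiftᴸ : ∀ {M} → List (Poly M) → ℕ
    degShiftᴸ L.[]         = 0
    degShiftᴸ ps@(_ L.∷ _) = suc (degᴸ ps)

  degShiftᴸ≤ : ∀ {M} (ps : List (Poly M)) → degShiftᴸ ps ≤ suc (degᴸ ps)
  degShiftᴸ≤ L.[]      = z≤n
  degShiftᴸ≤ (_ L.∷ _) = ≤-refl

  deg-0ᴾ : ∀ {M} → deg (0ᴾ {M}) ≡ 0
  deg-0ᴾ {zero}  = refl
  deg-0ᴾ {suc M} = refl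

  deg-constᴾ : ∀ {M} a → deg (constᴾ {M} a) ≡ 0
  deg-constᴾ {zero}  a = refl
  deg-constᴾ {suc M} a = ≡.trans (NP.⊔-identityʳ (deg (constᴾ {M} a))) (deg-constᴾ {M} a)

  deg-varᴾ : ∀ {M} (i : Fin M) → deg (varᴾ i) ≤ 1
  deg-varᴾ {suc M} F.zero    rewrite deg-0ᴾ {M} | deg-constᴾ {M} 1# = ≤-refl
  deg-varᴾ {suc M} (F.suc i) rewrite NP.⊔-identityʳ (deg (varᴾ i)) = deg-varᴾ i

  private
    ⊔-interchange-≤ : ∀ {a b w x y z} → a ≤ w ⊔ x → b ≤ y ⊔ z → a ⊔ b ≤ (w ⊔ y) ⊔ (x ⊔ z)
    ⊔-interchange-≤ {w = w} {x} {y} {z} a≤ b≤ =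
      ⊔-lub (≤-trans a≤ (⊔-mono-≤ (m≤m⊔n w y) (m≤m⊔n x z)))
            (≤-trans b≤ (⊔-mono-≤ (m≤n⊔m w y) (m≤n⊔m x z)))

  mutual
    deg-+ᴾ : ∀ {M} (p r : Poly M) → deg (p +ᴾ r) ≤ deg p ⊔ deg r
    deg-+ᴾ (con a)   (con b)   = z≤n
    deg-+ᴾ (poly ps) (poly rs) = degᴸ-+ᴸ ps rs

    degᴸ-+ᴸ : ∀ {M} (ps rs : List (Poly M)) → degᴸ (ps +ᴸ rs) ≤ degᴸ ps ⊔ degᴸ rs
    degᴸ-+ᴸ L.[]       rs         = ≤-refl
    degᴸ-+ᴸ (p L.∷ ps) L.[]       = m≤m⊔n _ 0
    degᴸ-+ᴸ (p L.∷ ps) (r L.∷ rs) =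
      ⊔-interchange-≤ {w = deg p} {deg r} {degShiftᴸ ps} {degShiftᴸ rs} (deg-+ᴾ p r) (degShiftᴸ-+ᴸ ps rs)

    degShiftᴸ-+ᴸ : ∀ {M} (ps rs : List (Poly M)) → degShiftᴸ (ps +ᴸ rs) ≤ degShiftᴸ ps ⊔ degShiftᴸ rs
    degShiftᴸ-+ᴸ L.[]       rs         = ≤-refl
    degShiftᴸ-+ᴸ (p L.∷ ps) L.[]       = m≤m⊔n _ 0
    degShiftᴸ-+ᴸ (p L.∷ ps) (r L.∷ rs) = s≤s (degᴸ-+ᴸ (p L.∷ ps) (r L.∷ rs))

  mutual
    deg-*ᴾ : ∀ {M} (p r : Poly M) → deg (p *ᴾ r) ≤ deg p + deg r
    deg-*ᴾ (con a)   (con b)   = z≤n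
    deg-*ᴾ (poly ps) (poly rs) = degᴸ-*ᴸ ps rs

    degᴸ-*ᴸ : ∀ {M} (ps rs : List (Poly M)) → degᴸ (ps *ᴸ rs) ≤ degᴸ ps + degᴸ rs
    degᴸ-*ᴸ L.[]           rs = z≤n
    degᴸ-*ᴸ {M} (p L.∷ ps) rs = begin
      degᴸ (p ·ᴸ rs +ᴸ (0ᴾ L.∷ ps *ᴸ rs))                 ≤⟨ degᴸ-+ᴸ (p ·ᴸ rs) (0ᴾ L.∷ ps *ᴸ rs) ⟩
      degᴸ (p ·ᴸ rs) ⊔ (deg (0ᴾ {M}) ⊔ degShiftᴸ (ps *ᴸ rs))
        ≡⟨ cong (λ d → degᴸ (p ·ᴸ rs) ⊔ (d ⊔ degShiftᴸ (ps *ᴸ rs))) (deg-0ᴾ {M}) ⟩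
      degᴸ (p ·ᴸ rs) ⊔ degShiftᴸ (ps *ᴸ rs)
        ≤⟨ ⊔-mono-≤ (degᴸ-·ᴸ p rs) (degShiftᴸ-*ᴸ ps rs) ⟩
      (deg p + degᴸ rs) ⊔ (degShiftᴸ ps + degᴸ rs)           ≡⟨ NP.+-distribʳ-⊔ (degᴸ rs) (deg p) (degShiftᴸ ps) ⟨
      degᴸ (p L.∷ ps) + degᴸ rs                              ∎
      where open NP.≤-Reasoning

    degShiftᴸ-*ᴸ : ∀ {M} (ps rs : List (Poly M)) → degShiftᴸ (ps *ᴸ rs) ≤ degShiftᴸ ps + degᴸ rs
    degShiftᴸ-*ᴸ L.[]         rs = z≤n
    degShiftᴸ-*ᴸ ps@(_ L.∷ _) rs = ≤-trans (degShiftᴸ≤ (ps *ᴸ rs)) (s≤s (degᴸ-*ᴸ ps rs))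

    degᴸ-·ᴸ : ∀ {M} (p : Poly M) rs → degᴸ (p ·ᴸ rs) ≤ deg p + degᴸ rs
    degᴸ-·ᴸ p L.[]       = z≤n
    degᴸ-·ᴸ p (r L.∷ rs) = ≤-trans (⊔-mono-≤ (deg-*ᴾ p r) (degShiftᴸ-·ᴸ p rs))
                                   (≤-reflexive (≡.sym (NP.+-distribˡ-⊔ (deg p) (deg r) (degShiftᴸ rs))))

    degShiftᴸ-·ᴸ : ∀ {M} (p : Poly M) rs → degShiftᴸ (p ·ᴸ rs) ≤ deg p + degShiftᴸ rs
    degShiftᴸ-·ᴸ p L.[]         = z≤n
    degShiftᴸ-·ᴸ p rs@(_ L.∷ _) = ≤-trans (s≤s (degᴸ-·ᴸ p rs)) (≤-reflexive (≡.sym (NP.+-suc (deg p) _)))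

module SchwartzZippel {c ℓ} (𝔽 : FiniteField c ℓ) where
  open FiniteField 𝔽 using (Carrier; _≈_; 0#; q; elt)
  module 𝔽 = FiniteField 𝔽
  open FieldFacts 𝔽 using (_≈?_; ≈-stable)
  open Univariate 𝔽 using (horner; HasDegree; leading; later; AllZero; horner-allZero; #roots; #roots≤q; #roots≤degree)
  open Multivariate 𝔽
  open Degree 𝔽
  open NatSums using (indicator; sum; sum-syntax; sum-cong-≗)
  open Vectors q
  open import Data.Nat using (_+_; _*_; _^_; _≤_)
  open NP using (≤-trans; ≤-reflexive; m≤m+n; m≤n+m)
  open import Relation.Nullary.Decidable using (¬?)
  import Data.Vec as Vec

  point : ∀ {M} → Vec (Fin q) M → Vec Carrier M
  point = Vec.map elt

  Vanishes : ∀ {M} → Poly M → Set ℓ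
  Vanishes p = ∀ s → eval p (point s) ≈ 0#

  NonVanishing : ∀ {M} → Poly M → Set ℓ
  NonVanishing p = ∃ λ s → ¬ eval p (point s) ≈ 0#

  nonVanishing? : ∀ {M} (p : Poly M) → Dec (NonVanishing p)
  nonVanishing? {M} p = any? M (λ s → ¬? (eval p (point s) ≈? 0#))

  ¬NonVanishing⇒Vanishes : ∀ {M} (p : Poly M) → ¬ NonVanishing p → Vanishes p
  ¬NonVanishing⇒Vanishes p ¬nv s = ≈-stable λ p≉0 → ¬nv (s , p≉0)

  ¬Vanishes⇒NonVanishing : ∀ {M} (p : Poly M) → ¬ Vanishes p → NonVanishing p
  ¬Vanishes⇒NonVanishing p ¬v with nonVanishing? p
  ... | yes nv = nv
  ... | no ¬nv = ⊥-elim (¬v (¬NonVanishing⇒Vanishes p ¬nv))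

  vanishes? : ∀ {M} (p : Poly M) → Dec (Vanishes p)
  vanishes? p with nonVanishing? p
  ... | yes (s , p≉0) = no λ vanishes → p≉0 (vanishes s)
  ... | no ¬nv        = yes (¬NonVanishing⇒Vanishes p ¬nv)

  #zeros : ∀ {M} → Poly M → ℕ
  #zeros {M} p = ∑ᵛ M (λ s → indicator (eval p (point s) ≈? 0#))

  data LastNonVanishing {M} : List (Poly M) → ℕ → Poly M → Set (c Level.⊔ ℓ) where
    here  : ∀ {p ps} → NonVanishing p → All Vanishes ps → LastNonVanishing (p L.∷ ps) 0 p
    there : ∀ {p ps j c} → LastNonVanishing ps j c → LastNonVanishing (p L.∷ ps) (suc j) c

  lastNonVanishing : ∀ {M} (ps : List (Poly M)) → ¬ All Vanishes ps → ∃ λ j → ∃ (LastNonVanishing ps j)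
  lastNonVanishing L.[]       ¬vanish = ⊥-elim (¬vanish All.[])
  lastNonVanishing (p L.∷ ps) ¬vanish with All.all? vanishes? ps
  ... | yes vanish = 0 , p , here (¬Vanishes⇒NonVanishing p λ v → ¬vanish (v All.∷ vanish)) vanish
  ... | no ¬vanish′ with lastNonVanishing ps ¬vanish′
  ... | j , c , last = suc j , c , there last

  nonVanishing-last : ∀ {M} {ps : List (Poly M)} {j c} → LastNonVanishing ps j c → NonVanishing c
  nonVanishing-last (here nv _) = nv
  nonVanishing-last (there last) = nonVanishing-last last

  deg-last : ∀ {M} {ps : List (Poly M)} {j c} → LastNonVanishing ps j c → deg c + j ≤ degᴸ ps
  deg-last {c = c} (here {ps = ps} _ _) = ≤-trans (≤-reflexive (NP.+-identityʳ (deg c))) (NP.m≤m⊔n (deg c) (degShiftᴸ ps))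
  deg-last {j = suc j} {c} (there {p = p} {ps = ps@(_ L.∷ _)} last) = begin
    deg c + suc j              ≡⟨ NP.+-suc (deg c) j ⟩
    suc (deg c + j)            ≤⟨ Data.Nat.s≤s (deg-last last) ⟩
    degShiftᴸ ps               ≤⟨ NP.m≤n⊔m (deg p) (degShiftᴸ ps) ⟩
    deg p ⊔ degShiftᴸ ps       ∎
    where
    open NP.≤-Reasoning
    open Data.Nat using (_⊔_)

  coefficients-allZero : ∀ {M} {ps : List (Poly M)} → All Vanishes ps → ∀ s → AllZero (coefficients ps (point s))
  coefficients-allZero All.[]           s = All.[]
  coefficients-allZero (v All.∷ vanish) s = v s All.∷ coefficients-allZero vanish s

  coefficients-degree : ∀ {M} {ps : List (Poly M)} {j c} → LastNonVanishing ps j c →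
    ∀ s → ¬ eval c (point s) ≈ 0# → HasDegree j (coefficients ps (point s))
  coefficients-degree (here _ vanish) s c≉0 = leading c≉0 (coefficients-allZero vanish s)
  coefficients-degree (there last)    s c≉0 = later (coefficients-degree last s c≉0)

  #zeros-on-line : ∀ {M} (ps : List (Poly M)) s →
    ∑[ t < q ] indicator (eval (poly ps) (point (t ∷ s)) ≈? 0#) ≡ #roots (coefficients ps (point s))
  #zeros-on-line ps s = sum-cong-≗ {q} λ t →
    cong (λ y → indicator (y ≈? 0#)) (≡.sym (horner-coefficients ps (elt t) (point s)))

  #zeros-on-line≤ : ∀ {M} {ps : List (Poly M)} {j c} → LastNonVanishing ps j c → ∀ s →
    ∑[ t < q ] indicator (eval (poly ps) (point (t ∷ s)) ≈? 0#) ≤ q * indicator (eval c (point s) ≈? 0#) + j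
  #zeros-on-line≤ {ps = ps} {j} {c} last s rewrite #zeros-on-line ps s with eval c (point s) ≈? 0#
  ... | yes _   = ≤-trans (#roots≤q (coefficients ps (point s)))
                          (≤-trans (≤-reflexive (≡.sym (NP.*-identityʳ q))) (m≤m+n (q * 1) j))
  ... | no c≉0 = ≤-trans (#roots≤degree (coefficients-degree last s c≉0)) (m≤n+m j (q * 0))

  #zeros-poly≤ : ∀ {M} {ps : List (Poly M)} {j c} → LastNonVanishing ps j c →
    #zeros (poly ps) ≤ q * #zeros c + q ^ M * j
  #zeros-poly≤ {M} {ps} {j} {c} last = begin
    #zeros (poly ps)                                                  ≡⟨ ∑ᵛ-comm M _ ⟨
    ∑ᵛ M (λ s → ∑[ t < q ] indicator (eval (poly ps) (point (t ∷ s)) ≈? 0#))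
                                                                      ≤⟨ ∑ᵛ-mono-≤ M (#zeros-on-line≤ last) ⟩
    ∑ᵛ M (λ s → q * indicator (eval c (point s) ≈? 0#) + j)          ≡⟨ ∑ᵛ-distrib-+ M _ _ ⟩
    ∑ᵛ M (λ s → q * indicator (eval c (point s) ≈? 0#)) + ∑ᵛ M (λ _ → j)
                                                                      ≡⟨ cong₂ _+_ (∑ᵛ-distribˡ-* M q _) (∑ᵛ-const M j) ⟩
    q * #zeros c + q ^ M * j                                          ∎
    where open NP.≤-Reasoning

  private
    combine-bounds : ∀ q A B j d D → A * q ≤ d * B → d + j ≤ D → (q * A + B * j) * q ≤ D * (q * B)
    combine-bounds q A B j d D Aq≤dB d+j≤D = begin
      (q * A + B * j) * q        ≡⟨ solve 4 (λ q A B j → (q :* A :+ B :* j) :* q := q :* (A :* q) :+ j :* (q :* B)) refl q A B j ⟩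
      q * (A * q) + j * (q * B)  ≤⟨ NP.+-monoˡ-≤ (j * (q * B)) (NP.*-monoʳ-≤ q Aq≤dB) ⟩
      q * (d * B) + j * (q * B)  ≡⟨ solve 4 (λ q d B j → q :* (d :* B) :+ j :* (q :* B) := (d :+ j) :* (q :* B)) refl q d B j ⟩
      (d + j) * (q * B)          ≤⟨ NP.*-monoˡ-≤ (q * B) d+j≤D ⟩
      D * (q * B)                ∎
      where
      open NP.≤-Reasoning
      open import Data.Nat.Solver using (module +-*-Solver)
      open +-*-Solver

  coefficients-not-all-vanishing : ∀ {M} (ps : List (Poly M)) → NonVanishing (poly ps) → ¬ All Vanishes ps
  coefficients-not-all-vanishing ps (t ∷ s , p≉0) vanish =
    p≉0 (subst (_≈ 0#) (horner-coefficients ps (elt t) (point s)) (horner-allZero (coefficients-allZero vanish s) (elt t)))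

  schwartz-zippel : ∀ {M} (p : Poly M) → NonVanishing p → #zeros p * q ≤ deg p * q ^ M
  schwartz-zippel (con a) ([] , a≉0) with a ≈? 0#
  ... | yes a≈0 = ⊥-elim (a≉0 a≈0)
  ... | no _    = Data.Nat.z≤n
  schwartz-zippel {suc M} (poly ps) nv with lastNonVanishing ps (coefficients-not-all-vanishing ps nv)
  ... | j , c , last = ≤-trans (NP.*-monoˡ-≤ q (#zeros-poly≤ last))
                               (combine-bounds q (#zeros c) (q ^ M) j (deg c) (degᴸ ps)
                                 (schwartz-zippel c (nonVanishing-last last)) (deg-last last))

module Sequences where
  open import Data.Nat using (_≤_; z≤n; s≤s)
  open import Data.Nat.GeneralisedArithmetic using (iterate)

  shift : ∀ {a} {A : Set a} {ℓ} → (Fin (suc ℓ) → A) → Fin (suc ℓ) → A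
  shift {ℓ = zero}  x F.zero    = x F.zero
  shift {ℓ = suc ℓ} x F.zero    = x (F.suc F.zero)
  shift {ℓ = suc ℓ} x (F.suc i) = shift (x ∘ F.suc) i

  shift-inject₁ : ∀ {a} {A : Set a} {ℓ} (x : Fin (suc ℓ) → A) i → shift x (F.inject₁ i) ≡ x (F.suc i)
  shift-inject₁ {ℓ = suc ℓ} x F.zero    = refl
  shift-inject₁ {ℓ = suc ℓ} x (F.suc i) = shift-inject₁ (x ∘ F.suc) i

  shift-last : ∀ {a} {A : Set a} ℓ (x : Fin (suc ℓ) → A) → shift x (F.fromℕ ℓ) ≡ x (F.fromℕ ℓ)
  shift-last zero    x = refl
  shift-last (suc ℓ) x = shift-last ℓ (x ∘ F.suc)

  shift-related : ∀ {a r} {A : Set a} {ℓ} (R : A → A → Set r) (x : Fin (suc ℓ) → A) →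
    (∀ y → R y y) → (∀ i → R (x (F.inject₁ i)) (x (F.suc i))) → ∀ i → R (x i) (shift x i)
  shift-related {ℓ = zero}  R x R-refl R-step F.zero    = R-refl (x F.zero)
  shift-related {ℓ = suc ℓ} R x R-refl R-step F.zero    = R-step F.zero
  shift-related {ℓ = suc ℓ} R x R-refl R-step (F.suc i) = shift-related R (x ∘ F.suc) R-refl (R-step ∘ F.suc) i

  iterate-fixed : ∀ {a} {A : Set a} (f : A → A) {y} → f y ≡ y → ∀ k → iterate f y k ≡ y
  iterate-fixed f fy≡y zero    = refl
  iterate-fixed f fy≡y (suc k) = ≡.trans (cong (λ z → iterate f z k) fy≡y) (iterate-fixed f fy≡y k)

  iterate-along : ∀ {a} {A : Set a} {ℓ} (f : A → A) (x : Fin (suc ℓ) → A) →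
    (∀ i → f (x (F.inject₁ i)) ≡ x (F.suc i)) → f (x (F.fromℕ ℓ)) ≡ x (F.fromℕ ℓ) →
    ∀ {k} → ℓ ≤ k → iterate f (x F.zero) k ≡ x (F.fromℕ ℓ)
  iterate-along {ℓ = zero}  f x f-step f-last {k} z≤n = iterate-fixed f f-last k
  iterate-along {ℓ = suc ℓ} f x f-step f-last {suc k} (s≤s ℓ≤k) =
    ≡.trans (cong (λ z → iterate f z k) (f-step F.zero)) (iterate-along f (x ∘ F.suc) (f-step ∘ F.suc) f-last ℓ≤k)

module Paths {n} (G : Graph n) where
  open import Data.Nat using (_≤_; _∸_; s≤s)
  open import Data.Bool using (true; _∨_)
  import Data.Bool.Properties
  open Path

  -- The pairs (a , b) for which the entry A_{a,b} is not forced to be zero.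
  Step : Fin n → Fin n → Set
  Step a b = does (a F.≟ b) ∨ G a b ≡ true

  Step-refl : ∀ a → Step a a
  Step-refl a with a F.≟ a
  ... | yes _  = refl
  ... | no a≢a = ⊥-elim (a≢a refl)

  Step-edge : ∀ {a b} → G a b ≡ true → Step a b
  Step-edge {a} {b} edge = ≡.trans (cong (does (a F.≟ b) ∨_) edge) (Data.Bool.Properties.∨-zeroʳ _)

  trivial : ∀ w → Path G w w 0
  trivial w = record { vert = λ _ → w ; distinct = λ { {F.zero} {F.zero} _ → refl } ; start = refl ; end = refl ; edges = λ () }

  tail : ∀ {a b ℓ} (p : Path G a b (suc ℓ)) → Path G (vert p (F.suc F.zero)) b ℓ
  tail p = record
    { vert     = vert p ∘ F.suc
    ; distinct = FP.suc-injective ∘ distinct p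
    ; start    = refl
    ; end      = end p
    ; edges    = edges p ∘ F.suc
    }

  suffix : ∀ {a b ℓ} (p : Path G a b ℓ) (i : Fin (suc ℓ)) → Path G (vert p i) b (ℓ ∸ F.toℕ i)
  suffix p F.zero = record { vert = vert p ; distinct = distinct p ; start = refl ; end = end p ; edges = edges p }
  suffix {ℓ = suc ℓ} p (F.suc i) = suffix (tail p) i

  cons : ∀ {m z ℓ} w (p : Path G m z ℓ) → G w m ≡ true → (∀ i → vert p i ≢ w) → Path G w z (suc ℓ)
  cons {m} {z} {ℓ} w p edge fresh = record
    { vert = vert′ ; distinct = distinct′ ; start = refl ; end = end p ; edges = edges′ }
    where
    vert′ : Fin (suc (suc ℓ)) → Fin n
    vert′ F.zero    = w
    vert′ (F.suc i) = vert p i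
    distinct′ : ∀ {i j} → vert′ i ≡ vert′ j → i ≡ j
    distinct′ {F.zero}  {F.zero}  _  = refl
    distinct′ {F.zero}  {F.suc j} eq = ⊥-elim (fresh j (≡.sym eq))
    distinct′ {F.suc i} {F.zero}  eq = ⊥-elim (fresh i eq)
    distinct′ {F.suc i} {F.suc j} eq = cong F.suc (distinct p eq)
    edges′ : ∀ i → G (vert′ (F.inject₁ i)) (vert′ (F.suc i)) ≡ true
    edges′ F.zero    = subst (λ x → G w x ≡ true) (≡.sym (start p)) edge
    edges′ (F.suc i) = edges p i

  -- Loop erasure: if w already lies on the path, keep only the suffix starting at w.
  step-path : ∀ {w m z j} → Step w m → HasPathAtMost G m z j → HasPathAtMost G w z (suc j)
  step-path {w} {m} step (ℓ , ℓ≤j , p) with w F.≟ m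
  ... | yes refl = ℓ , NP.m≤n⇒m≤1+n ℓ≤j , p
  ... | no _ with FP.any? (λ i → vert p i F.≟ w)
  ... | yes (i , vᵢ≡w) =
    ℓ ∸ F.toℕ i , NP.≤-trans (NP.m∸n≤m ℓ (F.toℕ i)) (NP.m≤n⇒m≤1+n ℓ≤j) ,
    subst (λ x → Path G x _ _) vᵢ≡w (suffix p i)
  ... | no fresh = suc ℓ , s≤s ℓ≤j , cons w p step (λ i eq → fresh (i , eq))

module MatrixSums {c ℓ} (𝔽 : FiniteField c ℓ) where
  open FiniteField 𝔽 renaming (refl to ≈-refl)
  open FieldFacts 𝔽 using (_≈?_)
  open Matrices 𝔽 using (sumF)
  open import Data.Bool using (Bool; if_then_else_)

  δ : Bool → Carrier
  δ b = if b then 1# else 0#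

  sumF-cong : ∀ m {f g : Fin m → Carrier} → (∀ i → f i ≈ g i) → sumF m f ≈ sumF m g
  sumF-cong zero    f≈g = ≈-refl
  sumF-cong (suc m) f≈g = +-cong (f≈g F.zero) (sumF-cong m (f≈g ∘ F.suc))

  sumF-zero : ∀ m → sumF m (λ _ → 0#) ≈ 0#
  sumF-zero zero    = ≈-refl
  sumF-zero (suc m) = trans (+-identityˡ _) (sumF-zero m)

  sumF-δ : ∀ m (i₀ : Fin m) (g : Fin m → Carrier) → sumF m (λ i → δ (does (i₀ F.≟ i)) * g i) ≈ g i₀
  sumF-δ (suc m) F.zero g = begin
    sumF (suc m) (λ i → δ (does (F.zero F.≟ i)) * g i)
      ≈⟨ +-cong (*-identityˡ (g F.zero)) (trans (sumF-cong m (λ i → zeroˡ (g (F.suc i)))) (sumF-zero m)) ⟩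
    g F.zero + 0#  ≈⟨ +-identityʳ _ ⟩
    g F.zero       ∎
    where open SetoidReasoning setoid
  sumF-δ (suc m) (F.suc i₀) g = begin
    sumF (suc m) (λ i → δ (does (F.suc i₀ F.≟ i)) * g i)
      ≈⟨ +-cong (zeroˡ (g F.zero)) (sumF-cong m (λ i → *-congʳ (δ-suc i))) ⟩
    0# + sumF m (λ i → δ (does (i₀ F.≟ i)) * g (F.suc i))  ≈⟨ +-identityˡ _ ⟩
    sumF m (λ i → δ (does (i₀ F.≟ i)) * g (F.suc i))       ≈⟨ sumF-δ m i₀ (g ∘ F.suc) ⟩
    g (F.suc i₀)                                            ∎
    where
    open SetoidReasoning setoid
    δ-suc : ∀ i → δ (does (F.suc i₀ F.≟ F.suc i)) ≈ δ (does (i₀ F.≟ i))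
    δ-suc i with i₀ F.≟ i
    ... | yes _ = ≈-refl
    ... | no _  = ≈-refl

  sumF-nonzero : ∀ m (f : Fin m → Carrier) → ¬ sumF m f ≈ 0# → ∃ λ i → ¬ f i ≈ 0#
  sumF-nonzero zero    f ∑≉0 = ⊥-elim (∑≉0 ≈-refl)
  sumF-nonzero (suc m) f ∑≉0 with f F.zero ≈? 0#
  ... | no f₀≉0 = F.zero , f₀≉0
  ... | yes f₀≈0 with sumF-nonzero m (f ∘ F.suc) (λ ∑≈0 → ∑≉0 (trans (+-cong f₀≈0 ∑≈0) (+-identityʳ 0#)))
  ... | i , fᵢ≉0 = F.suc i , fᵢ≉0

module FormalMatrix {c ℓ} (𝔽 : FiniteField c ℓ) {n} (G : Graph n) where
  open FiniteField 𝔽 using (_≈_; 1#; elt)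
  module 𝔽 = FiniteField 𝔽
  open Matrices 𝔽 using (sumF; _^ᴹ_; Sample; matA)
  open MatrixSums 𝔽 using (sumF-cong)
  open Multivariate 𝔽
  open Degree 𝔽
  open SchwartzZippel 𝔽 using (point)
  open import Data.Nat using (_+_; _*_; _≤_; _⊔_; z≤n)
  open import Data.Bool using (true; false; _∨_; if_then_else_)
  open import Data.Vec using (lookup)
  import Data.Vec.Properties as VecP

  Variables : ℕ
  Variables = n * n + n

  x̂ : Fin n → Fin n → Poly Variables
  x̂ a b = varᴾ (F.combine a b F.↑ˡ n)

  ŷ : Fin n → Poly Variables
  ŷ b = varᴾ ((n * n) F.↑ʳ b)

  Â : Fin n → Fin n → Poly Variables
  Â a b = if does (a F.≟ b) ∨ G a b then x̂ a b *ᴾ ŷ b else 0ᴾ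

  ∑ᴾ : ∀ m → (Fin m → Poly Variables) → Poly Variables
  ∑ᴾ zero    f = 0ᴾ
  ∑ᴾ (suc m) f = f F.zero +ᴾ ∑ᴾ m (f ∘ F.suc)

  Â^ : ℕ → Fin n → Fin n → Poly Variables
  Â^ zero    a b = if does (a F.≟ b) then constᴾ 1# else 0ᴾ
  Â^ (suc k) a b = ∑ᴾ n (λ m → Â a m *ᴾ Â^ k m b)

  eval-∑ᴾ : ∀ m f env → eval (∑ᴾ m f) env ≈ sumF m (λ i → eval (f i) env)
  eval-∑ᴾ zero    f env = eval-0ᴾ env
  eval-∑ᴾ (suc m) f env = 𝔽.trans (eval-+ᴾ (f F.zero) (∑ᴾ m (f ∘ F.suc)) env) (𝔽.+-congˡ (eval-∑ᴾ m (f ∘ F.suc) env))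

  eval-varᴾ-point : ∀ i (s : Sample n) → eval (varᴾ i) (point s) ≈ elt (lookup s i)
  eval-varᴾ-point i s = 𝔽.trans (eval-varᴾ i (point s)) (𝔽.reflexive (VecP.lookup-map i elt s))

  eval-Â : ∀ s a b → eval (Â a b) (point s) ≈ matA G s a b
  eval-Â s a b with does (a F.≟ b) ∨ G a b
  ... | true  = 𝔽.trans (eval-*ᴾ (x̂ a b) (ŷ b) (point s)) (𝔽.*-cong (eval-varᴾ-point _ s) (eval-varᴾ-point _ s))
  ... | false = eval-0ᴾ (point s)

  eval-Â^ : ∀ s k a b → eval (Â^ k a b) (point s) ≈ (matA G s ^ᴹ k) a b
  eval-Â^ s zero    a b with does (a F.≟ b)
  ... | true  = eval-constᴾ 1# (point s)
  ... | false = eval-0ᴾ (point s)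
  eval-Â^ s (suc k) a b = 𝔽.trans (eval-∑ᴾ n _ (point s)) (sumF-cong n λ m →
    𝔽.trans (eval-*ᴾ (Â a m) (Â^ k m b) (point s)) (𝔽.*-cong (eval-Â s a m) (eval-Â^ s k m b)))

  deg-∑ᴾ : ∀ m f {d} → (∀ i → deg (f i) ≤ d) → deg (∑ᴾ m f) ≤ d
  deg-∑ᴾ zero    f _  = NP.≤-trans (NP.≤-reflexive (deg-0ᴾ {Variables})) z≤n
  deg-∑ᴾ (suc m) f fᵢ≤d = NP.≤-trans (deg-+ᴾ (f F.zero) (∑ᴾ m (f ∘ F.suc)))
                                    (NP.⊔-lub (fᵢ≤d F.zero) (deg-∑ᴾ m (f ∘ F.suc) (fᵢ≤d ∘ F.suc)))

  deg-Â : ∀ a b → deg (Â a b) ≤ 2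
  deg-Â a b with does (a F.≟ b) ∨ G a b
  ... | true  = NP.≤-trans (deg-*ᴾ (x̂ a b) (ŷ b))
                           (NP.+-mono-≤ (deg-varᴾ (F.combine a b F.↑ˡ n)) (deg-varᴾ ((n * n) F.↑ʳ b)))
  ... | false = NP.≤-trans (NP.≤-reflexive (deg-0ᴾ {Variables})) z≤n

  deg-Â^ : ∀ k a b → deg (Â^ k a b) ≤ 2 * k
  deg-Â^ zero    a b with does (a F.≟ b)
  ... | true  = NP.≤-reflexive (deg-constᴾ {Variables} 1#)
  ... | false = NP.≤-reflexive (deg-0ᴾ {Variables})
  deg-Â^ (suc k) a b = deg-∑ᴾ n _ λ m → NP.≤-trans (deg-*ᴾ (Â a m) (Â^ k m b))
    (NP.≤-trans (NP.+-mono-≤ (deg-Â a m) (deg-Â^ k m b)) (NP.≤-reflexive (≡.sym (NP.*-suc 2 k))))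

module RandomMatrix {c ℓ} (𝔽 : FiniteField c ℓ) {n} (G : Graph n) where
  open FiniteField 𝔽 renaming (refl to ≈-refl)
  open FieldFacts 𝔽
  open Matrices 𝔽
  open MatrixSums 𝔽
  open Paths G
  open Sequences
  open import Data.Nat using (_≤_; z≤n)
  open import Data.Nat.GeneralisedArithmetic using (iterate)
  open import Data.Bool using (true; false; _∨_)
  open import Data.Vec using (lookup; tabulate)
  import Data.Vec.Properties as VecP
  open import Data.Sum using (_⊎_; [_,_]′)
  open import Data.Product using (uncurry)
  open import Relation.Nullary.Decidable using (dec-true)
  open import Relation.Binary.PropositionalEquality using (subst₂)
  import Data.Nat as ℕ

  Step-nonzero : ∀ s {a b} → ¬ matA G s a b ≈ 0# → Step a b
  Step-nonzero s {a} {b} A≉0 with does (a F.≟ b) ∨ G a b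
  ... | true  = refl
  ... | false = ⊥-elim (A≉0 ≈-refl)

  -- A nonzero entry of Aʲ comes from a walk of length j, which contains a path.
  nonzero⇒path : ∀ s j {w z} → ¬ (matA G s ^ᴹ j) w z ≈ 0# → HasPathAtMost G w z j
  nonzero⇒path s zero {w} {z} Aʲ≉0 with w F.≟ z
  ... | yes refl = 0 , z≤n , trivial w
  ... | no _     = ⊥-elim (Aʲ≉0 ≈-refl)
  nonzero⇒path s (suc j) Aʲ≉0 with sumF-nonzero n _ Aʲ≉0
  ... | m , term≉0 = step-path (Step-nonzero s (nonzero-*ˡ term≉0)) (nonzero⇒path s j (nonzero-*ʳ term≉0))

  sampleValue : (Fin n → Fin n → Carrier) → (Fin n → Carrier) → Fin (n ℕ.* n) ⊎ Fin n → Fin q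
  sampleValue X Y = [ index ∘ uncurry X ∘ F.remQuot n , index ∘ Y ]′

  sampleOf : (Fin n → Fin n → Carrier) → (Fin n → Carrier) → Sample n
  sampleOf X Y = tabulate (sampleValue X Y ∘ F.splitAt (n ℕ.* n))

  xval-sampleOf : ∀ X Y a b → xval (sampleOf X Y) a b ≈ X a b
  xval-sampleOf X Y a b = begin
    elt (lookup (sampleOf X Y) (F.combine a b F.↑ˡ n))  ≡⟨ cong elt (VecP.lookup∘tabulate _ (F.combine a b F.↑ˡ n)) ⟩
    elt (sampleValue X Y (F.splitAt (n ℕ.* n) (F.combine a b F.↑ˡ n)))
      ≡⟨ cong (elt ∘ sampleValue X Y) (FP.splitAt-↑ˡ (n ℕ.* n) (F.combine a b) n) ⟩
    elt (index (uncurry X (F.remQuot n (F.combine a b))))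
      ≡⟨ cong (λ ab → elt (index (uncurry X ab))) (FP.remQuot-combine a b) ⟩
    elt (index (X a b))                                  ≈⟨ elt-index (X a b) ⟩
    X a b                                                ∎
    where open SetoidReasoning setoid

  yval-sampleOf : ∀ X Y b → yval (sampleOf X Y) b ≈ Y b
  yval-sampleOf X Y b = begin
    elt (lookup (sampleOf X Y) ((n ℕ.* n) F.↑ʳ b))  ≡⟨ cong elt (VecP.lookup∘tabulate _ ((n ℕ.* n) F.↑ʳ b)) ⟩
    elt (sampleValue X Y (F.splitAt (n ℕ.* n) ((n ℕ.* n) F.↑ʳ b)))
      ≡⟨ cong (elt ∘ sampleValue X Y) (FP.splitAt-↑ʳ (n ℕ.* n) n b) ⟩
    elt (index (Y b))                                ≈⟨ elt-index (Y b) ⟩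
    Y b                                              ∎
    where open SetoidReasoning setoid

  ^ᴹ-functional : ∀ (B : Mat n) (f : Fin n → Fin n) → (∀ a b → B a b ≈ δ (does (f a F.≟ b))) →
    ∀ k a b → (B ^ᴹ k) a b ≈ δ (does (iterate f a k F.≟ b))
  ^ᴹ-functional B f B≈f zero    a b = ≈-refl
  ^ᴹ-functional B f B≈f (suc k) a b = begin
    sumF n (λ m → B a m * (B ^ᴹ k) m b)
      ≈⟨ sumF-cong n (λ m → *-cong (B≈f a m) (^ᴹ-functional B f B≈f k m b)) ⟩
    sumF n (λ m → δ (does (f a F.≟ m)) * δ (does (iterate f m k F.≟ b)))
      ≈⟨ sumF-δ n (f a) (λ m → δ (does (iterate f m k F.≟ b))) ⟩
    δ (does (iterate f (f a) k F.≟ b))  ∎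
    where open SetoidReasoning setoid

  -- Put weight 1 on the path edges and on the loop at its end, 0 elsewhere: A becomes the matrix of
  -- "move one step along the path", so Aᵏ sends u to v.
  module PathSample {u v ℓ} (p : Path G u v ℓ) where
    open Path p

    next : Fin n → Fin n
    next a with FP.any? (λ i → vert i F.≟ a)
    ... | yes (i , _) = shift vert i
    ... | no _        = a

    next-vert : ∀ i → next (vert i) ≡ shift vert i
    next-vert i with FP.any? (λ j → vert j F.≟ vert i)
    ... | yes (j , vⱼ≡vᵢ) = cong (shift vert) (distinct vⱼ≡vᵢ)
    ... | no none         = ⊥-elim (none (i , refl))

    Step-next : ∀ a → Step a (next a)
    Step-next a with FP.any? (λ i → vert i F.≟ a)
    ... | yes (i , refl) = shift-related Step vert Step-refl (Step-edge ∘ edges) i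
    ... | no _           = Step-refl a

    iterate-next : ∀ {k} → ℓ ≤ k → iterate next u k ≡ v
    iterate-next {k} ℓ≤k = subst₂ (λ x y → iterate next x k ≡ y) start end
      (iterate-along next vert (λ i → ≡.trans (next-vert (F.inject₁ i)) (shift-inject₁ vert i))
                               (≡.trans (next-vert (F.fromℕ ℓ)) (shift-last ℓ vert)) ℓ≤k)

    weight : Fin n → Fin n → Carrier
    weight a b = δ (does (next a F.≟ b))

    sample : Sample n
    sample = sampleOf weight (λ _ → 1#)

    matA-sample : ∀ a b → matA G sample a b ≈ weight a b
    matA-sample a b with next a F.≟ b | xval-sampleOf weight (λ _ → 1#) a b
    ... | yes refl | x≈1 rewrite Step-next a = trans (*-cong x≈1 (yval-sampleOf weight (λ _ → 1#) b)) (*-identityˡ 1#)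
    ... | no _     | x≈0 with does (a F.≟ b) ∨ G a b
    ...   | true  = trans (*-congʳ x≈0) (zeroˡ _)
    ...   | false = ≈-refl

    nonzero : ∀ {k} → ℓ ≤ k → ¬ (matA G sample ^ᴹ k) u v ≈ 0#
    nonzero {k} ℓ≤k Aᵏ≈0 = 1≉0 (begin
      1#                                       ≡⟨ cong δ (dec-true (iterate next u k F.≟ v) (iterate-next ℓ≤k)) ⟨
      δ (does (iterate next u k F.≟ v))        ≈⟨ ^ᴹ-functional (matA G sample) next matA-sample k u v ⟨
      (matA G sample ^ᴹ k) u v                 ≈⟨ Aᵏ≈0 ⟩
      0#                                       ∎)
      where open SetoidReasoning setoid

  path⇒nonzero : ∀ {u v k} → HasPathAtMost G u v k → ∃ λ s → ¬ (matA G s ^ᴹ k) u v ≈ 0#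
  path⇒nonzero (ℓ , ℓ≤k , p) = sample , nonzero ℓ≤k
    where open PathSample p

module Probability {c ℓ} (𝔽 : FiniteField c ℓ) {n} (G : Graph n) (u v : Fin n) (k : ℕ) where
  open FiniteField 𝔽 using (Carrier; _≈_; 0#; q)
  module 𝔽 = FiniteField 𝔽
  open FieldFacts 𝔽 using (_≈?_)
  open Matrices 𝔽
  open NatSums using (indicator; indicator-¬?)
  open Vectors q
  open SchwartzZippel 𝔽 using (#zeros; schwartz-zippel)
  open FormalMatrix 𝔽 G using (Variables; Â^; eval-Â^; deg-Â^)
  open RandomMatrix 𝔽 G using (nonzero⇒path; path⇒nonzero)
  open import Data.Nat using (_+_; _*_; _^_; _≤_)
  open import Relation.Nullary.Decidable using (¬?)
  open import Function using (mk⇔)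
  import Data.List.Relation.Unary.All.Properties as AllP

  entry : Sample n → Carrier
  entry s = (matA G s ^ᴹ k) u v

  nonzero? : ∀ s → Dec (¬ entry s ≈ 0#)
  nonzero? s = ¬? (entry s ≈? 0#)

  Event-nonzero : ∀ s → ¬ entry s ≈ 0# → Event G u v k s
  Event-nonzero s entry≉0 = mk⇔ (nonzero⇒path s k) (λ _ → entry≉0)

  indicator-cong : ∀ {x y} → x ≈ y → indicator (x ≈? 0#) ≡ indicator (y ≈? 0#)
  indicator-cong {x} {y} x≈y with x ≈? 0# | y ≈? 0#
  ... | yes _   | yes _   = refl
  ... | no _    | no _    = refl
  ... | yes x≈0 | no y≉0  = ⊥-elim (y≉0 (𝔽.trans (𝔽.sym x≈y) x≈0))
  ... | no x≉0  | yes y≈0 = ⊥-elim (x≉0 (𝔽.trans x≈y y≈0))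

  #nonzero+#zeros : length (filter nonzero? (allVecs Variables)) + #zeros (Â^ k u v) ≡ q ^ Variables
  #nonzero+#zeros = begin
    length (filter nonzero? (allVecs Variables)) + #zeros (Â^ k u v)
      ≡⟨ cong₂ _+_ (length-filter-allVecs Variables nonzero?)
                   (∑ᵛ-cong Variables (λ s → indicator-cong (eval-Â^ s k u v))) ⟩
    ∑ᵛ Variables (indicator ∘ nonzero?) + ∑ᵛ Variables (λ s → indicator (entry s ≈? 0#))
      ≡⟨ ∑ᵛ-distrib-+ Variables _ _ ⟨
    ∑ᵛ Variables (λ s → indicator (nonzero? s) + indicator (entry s ≈? 0#))
      ≡⟨ ∑ᵛ-cong Variables (λ s → indicator-¬? (entry s ≈? 0#)) ⟩
    ∑ᵛ Variables (λ _ → 1)                     ≡⟨ ∑ᵛ-const Variables 1 ⟩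
    q ^ Variables * 1                          ≡⟨ NP.*-identityʳ _ ⟩
    q ^ Variables                              ∎
    where open ≡-Reasoning

  #zeros≤ : ∀ s → ¬ entry s ≈ 0# → #zeros (Â^ k u v) * q ≤ 2 * k * q ^ Variables
  #zeros≤ s entry≉0 =
    NP.≤-trans (schwartz-zippel (Â^ k u v) (s , λ Â^≈0 → entry≉0 (𝔽.trans (𝔽.sym (eval-Â^ s k u v)) Â^≈0)))
               (NP.*-monoˡ-≤ (q ^ Variables) (deg-Â^ k u v))

  private
    complement-bound : ∀ q Q a b t → a + b ≡ Q → b * q ≤ t * Q → q * Q ≤ a * q + t * Q
    complement-bound q Q a b t a+b≡Q bq≤tQ = begin
      q * Q          ≡⟨ NP.*-comm q Q ⟩
      Q * q          ≡⟨ cong (_* q) a+b≡Q ⟨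
      (a + b) * q    ≡⟨ NP.*-distribʳ-+ q a b ⟩
      a * q + b * q  ≤⟨ NP.+-monoʳ-≤ (a * q) bq≤tQ ⟩
      a * q + t * Q  ∎
      where open NP.≤-Reasoning

  probability : ProbAtLeast1- n (Event G u v k) (2 * k)
  probability with any? Variables nonzero?
  ... | yes (s , entry≉0) =
    nonzeros , UP.filter⁺ nonzero? (allVecs-unique Variables) ,
    All.map (λ {s} → Event-nonzero s) (AllP.all-filter nonzero? (allVecs Variables)) ,
    complement-bound q (q ^ Variables) (length nonzeros) (#zeros (Â^ k u v)) (2 * k) #nonzero+#zeros (#zeros≤ s entry≉0)
    where nonzeros = filter nonzero? (allVecs Variables)
  ... | no none =
    allVecs Variables , allVecs-unique Variables , All.universal event (allVecs Variables) ,
    NP.≤-trans (NP.≤-reflexive (≡.trans (NP.*-comm q (q ^ Variables)) (cong (_* q) (≡.sym (length-allVecs Variables)))))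
               (NP.m≤m+n _ _)
    where
    event : ∀ s → Event G u v k s
    event s = mk⇔ (λ entry≉0 → ⊥-elim (none (s , entry≉0))) (λ path → ⊥-elim (none (path⇒nonzero path)))

open import Data.Nat using (_≤_; _∸_; _*_)

lemma9 : ∀ {c ℓ} (𝔽 : FiniteField c ℓ) (n : ℕ) (G : Graph n) (u v : Fin n) (k : ℕ) →
    1 ≤ k → k ≤ n ∸ 1 →
    Matrices.ProbAtLeast1- 𝔽 n (Matrices.Event 𝔽 G u v k) (2 * k)
-- The bound holds for every k.
lemma9 𝔽 n G u v k _ _ = Probability.probability 𝔽 G u v k
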